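{- Let $2\le k\le n$ and let $(\sigma_0,\sigma_1,\dots,\sigma_t)$ be a sequence of swaps with $\sigma_t^T(o_1)=k$ and $\sigma_t^T(o_n)=k-1$. Let $o_a,o_b$ be objects with $1\le a<b\le n$, $a'=\sigma_t^T(o_a)$, $b'=\sigma_t^T(o_b)$, and assume $a'>a$, $b'<b$ and $Q=[a,a']\cap[b,b']\neq\emptyset$. Let $Q'=[a+1,a']\cap[b,b']$ and $c=a'+b'-k+1$. Then (a) $c\in Q'$ and some swap in the sequence includes both $o_a$ and $o_b$ and happens between agents $c-1$ and $c$; (b) $o_b\succ_q o_a$ for all $q$ with $\max(a,b')\le q<c$, and $o_a\succ_q o_b$ for all $q$ with $c\le q\le\min(a',b)$.
   Context: Agents $N=\{1,\dots,n\}$ lie on a path in this order (edges between $i$ and $i+1$); objects $O=\{o_1,\dots,o_n\}$; each agent $i$ has a strict preference $\succ_i$ (a linear order on $O$); the initial assignment is $\sigma_0(i)=o_i$. A swap exchanges the objects of two adjacent agents in an assignment and is allowed only if both strictly prefer the object they receive. A sequence of swaps $(\sigma_0,\dots,\sigma_t)$ starts at the initial assignment and each $\sigma_r$ arises from $\sigma_{r-1}$ by an allowed swap. $\sigma^T(o)$ denotes the agent holding $o$ in $\sigma$. A swap includes an object if that object is one of the two exchanged. For integers $x,y$, $[x,y]$ denotes the set of integers between $x$ and $y$ inclusive, regardless of order. -}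

module Defs where

open import Level using (0ℓ)
open import Data.Nat using (ℕ; zero; suc; _+_; _∸_; _≤_; _<_; _⊔_; _⊓_)
open import Data.Fin using (Fin; toℕ)
open import Data.Fin.Permutation.Components using (transpose)
open import Data.Product using (Σ; ∃; _×_; _,_)
open import Data.Sum using (_⊎_)
open import Relation.Binary using (Rel; IsStrictTotalOrder)
open import Relation.Binary.PropositionalEquality using (_≡_)

-- 1-based position of an agent / index of an object:
-- agent (Fin n) i is agent number ⟦ i ⟧ ∈ {1..n}; object (Fin n) o is o_{⟦ o ⟧}.
⟦_⟧ : ∀ {n} → Fin n → ℕ
⟦ i ⟧ = suc (toℕ i)

-- An assignment maps each agent to the object it holds.
Assignment : ℕ → Set
Assignment n = Fin n → Fin n

-- Preference profile: P i x y  means  x ≻_i y  (agent i strictly prefers x to y).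
Prefs : ℕ → Set₁
Prefs n = Fin n → Rel (Fin n) 0ℓ

StrictLinear : ∀ {n} → Prefs n → Set
StrictLinear {n} P = (i : Fin n) → IsStrictTotalOrder _≡_ (P i)

IsInitial : ∀ {n} → Assignment n → Set
IsInitial σ = ∀ x → σ x ≡ x

SwapAt : ∀ {n} → Prefs n → Assignment n → Fin n → Fin n → Assignment n → Set
SwapAt P σ i j τ =
  (⟦ j ⟧ ≡ suc ⟦ i ⟧) ×
  P i (σ j) (σ i) ×
  P j (σ i) (σ j) ×
  (∀ x → τ x ≡ σ (transpose i j x))

Step : ∀ {n} → Prefs n → Assignment n → Assignment n → Set
Step {n} P σ τ = Σ (Fin n) λ i → Σ (Fin n) λ j → SwapAt P σ i j τ

IsSwapSeq : ∀ {n} → Prefs n → ℕ → (ℕ → Assignment n) → Set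
IsSwapSeq P t σ = IsInitial (σ 0) × (∀ r → r < t → Step P (σ r) (σ (suc r)))

HolderIs : ∀ {n} → Assignment n → Fin n → ℕ → Set
HolderIs σ o h = ∀ x → σ x ≡ o → ⟦ x ⟧ ≡ h

_∈[_,_] : ℕ → ℕ → ℕ → Set
q ∈[ x , y ] = (x ≤ q × q ≤ y) ⊎ (y ≤ q × q ≤ x)

SwapIncludesAt : ∀ {n} → Prefs n → ℕ → (ℕ → Assignment n) → Fin n → Fin n → ℕ → Set
SwapIncludesAt {n} P t σ oa ob c =
  Σ ℕ λ r → r < t × Σ (Fin n) λ i → Σ (Fin n) λ j →
    ⟦ i ⟧ ≡ c ∸ 1 × ⟦ j ⟧ ≡ c × SwapAt P (σ r) i j (σ (suc r)) ×
    ((σ r i ≡ oa × σ r j ≡ ob) ⊎ (σ r i ≡ ob × σ r j ≡ oa))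

-- Every swap moves its two objects one step in opposite directions and makes both agents
-- strictly better off, so an agent never gets back an object it gave away. Hence each object
-- moves in one direction only and two objects exchange places at most once. As o_a ends right
-- of o_b, they exchange exactly once, between agents c − 1 and c, after which o_a only moves
-- right and o_b only left. Objects never moving left end right of o_1, i.e. at positions ≥ k,
-- and objects never moving right end left of o_n, i.e. at positions ≤ k − 1. Counting the
-- objects that end at positions ≤ a′ and ≤ k − 1 in two ways shows that the objects overtaking
-- o_a after the exchange are exactly those ending in (b′, k − 1], whence a′ − c = k − 1 − b′.
-- For (b), every agent in the stated ranges holds one of o_a, o_b before the exchange and the
-- other one after it, and agents only ever improve.

module Submission where

open import Defs
open import Level using (0ℓ)
open import Data.Nat using (ℕ; zero; suc; _+_; _∸_; _≤_; _<_; _≤′_; ≤′-refl; ≤′-step; _⊔_; _⊓_; z≤n; s≤s; s≤s⁻¹; _≤?_; _<?_)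
open import Data.Nat.Properties
open import Data.Fin using (Fin; zero; fromℕ)
open import Data.Fin.Properties using (toℕ-injective; toℕ<n; toℕ-fromℕ) renaming (_≟_ to _≟ᶠ_)
open import Data.Fin.Permutation.Components using (transpose; transpose-inverse)
open import Data.Product using (Σ; Σ-syntax; _×_; _,_; proj₁; proj₂)
open import Data.Fin.Permutation using (permutation)
open import Data.Sum using (_⊎_; inj₁; inj₂; [_,_]; map₂)
open import Data.Empty using (⊥; ⊥-elim)
open import Function using (_∘_; _⇔_; mk⇔; Equivalence)
open import Relation.Nullary using (Dec; yes; no; ¬_)
open import Relation.Nullary.Decidable using (dec-yes-irr; _×-dec_; toSum)
open import Relation.Unary using (Pred; Decidable)
open import Relation.Binary using (IsStrictTotalOrder; Tri; tri<; tri≈; tri>)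
open import Relation.Binary.PropositionalEquality using (_≡_; _≢_; refl; sym; trans; cong; subst; subst₂; module ≡-Reasoning)
open import Algebra.Properties.CommutativeMonoid.Sum +-0-commutativeMonoid using (sum; ∑-distrib-+; sum-cong-≗; sum-permute)

transpose-cases : ∀ {m} (i j k : Fin m) →
  (k ≡ i × transpose i j k ≡ j) ⊎ (k ≡ j × transpose i j k ≡ i) ⊎ transpose i j k ≡ k
transpose-cases i j k with k ≟ᶠ i
... | yes k≡i = inj₁ (k≡i , refl)
... | no _ with k ≟ᶠ j
...   | yes k≡j = inj₂ (inj₁ (k≡j , refl))
...   | no _ = inj₂ (inj₂ refl)

module _ (f : ℕ → ℕ) where

  monotone-by-steps : (∀ r → f r ≤ f (suc r)) → ∀ {u v} → u ≤ v → f u ≤ f v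
  monotone-by-steps step {u} u≤v = go (≤⇒≤′ u≤v)
    where
    go : ∀ {v} → u ≤′ v → f u ≤ f v
    go ≤′-refl = ≤-refl
    go (≤′-step u≤′v) = ≤-trans (go u≤′v) (step _)

  antitone-by-steps : (∀ r → f (suc r) ≤ f r) → ∀ {u v} → u ≤ v → f v ≤ f u
  antitone-by-steps step {u} u≤v = go (≤⇒≤′ u≤v)
    where
    go : ∀ {v} → u ≤′ v → f v ≤ f u
    go ≤′-refl = ≤-refl
    go (≤′-step u≤′v) = ≤-trans (step _) (go u≤′v)

  intermediate-value↑ : (∀ r → f (suc r) ≤ suc (f r)) → ∀ {a b w} → a ≤ b → f a ≤ w → w ≤ f b →
                        Σ[ m ∈ ℕ ] a ≤ m × m ≤ b × f m ≡ w
  intermediate-value↑ step {a} {w = w} a≤b fa≤w = go (≤⇒≤′ a≤b)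
    where
    go : ∀ {b} → a ≤′ b → w ≤ f b → Σ[ m ∈ ℕ ] a ≤ m × m ≤ b × f m ≡ w
    go ≤′-refl w≤fa = a , ≤-refl , ≤-refl , ≤-antisym fa≤w w≤fa
    go {suc b} (≤′-step a≤′b) w≤fb+1 with w ≤? f b
    ... | yes w≤fb = let m , a≤m , m≤b , fm≡w = go a≤′b w≤fb in m , a≤m , m≤n⇒m≤1+n m≤b , fm≡w
    ... | no w≰fb = suc b , ≤′⇒≤ (≤′-step a≤′b) , ≤-refl , ≤-antisym (≤-trans (step b) (≰⇒> w≰fb)) w≤fb+1

  intermediate-value↓ : (∀ r → f r ≤ suc (f (suc r))) → ∀ {a b w} → a ≤ b → w ≤ f a → f b ≤ w →
                        Σ[ m ∈ ℕ ] a ≤ m × m ≤ b × f m ≡ w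
  intermediate-value↓ step {a} {w = w} a≤b w≤fa = go (≤⇒≤′ a≤b)
    where
    go : ∀ {b} → a ≤′ b → f b ≤ w → Σ[ m ∈ ℕ ] a ≤ m × m ≤ b × f m ≡ w
    go ≤′-refl fa≤w = a , ≤-refl , ≤-refl , ≤-antisym fa≤w w≤fa
    go {suc b} (≤′-step a≤′b) fb+1≤w with f b ≤? w
    ... | yes fb≤w = let m , a≤m , m≤b , fm≡w = go a≤′b fb≤w in m , a≤m , m≤n⇒m≤1+n m≤b , fm≡w
    ... | no fb≰w = suc b , ≤′⇒≤ (≤′-step a≤′b) , ≤-refl , ≤-antisym fb+1≤w (s≤s⁻¹ (≤-trans (≰⇒> fb≰w) (step b)))

  module _ (up : ∀ r → f (suc r) ≤ suc (f r)) (down : ∀ r → f r ≤ suc (f (suc r)))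
           (T : ℕ) (stays : ∀ {u m v} → u ≤ m → m ≤ v → v ≤ T → f u ≡ f v → f m ≡ f u) where

    private
      left-value-never-revisited : ∀ {u v} → u < v → v ≤ T → f (suc u) ≢ f u → f v ≢ f u
      left-value-never-revisited u<v v≤T moved fv≡fu = moved (stays (n≤1+n _) u<v v≤T (sym fv≡fu))

      entered-value-never-visited : ∀ {m s} → m ≤ s → s < T → f (suc s) ≢ f s → f m ≢ f (suc s)
      entered-value-never-visited m≤s s<T moved fm≡fs+1 = moved (trans (sym fm≡fs+1) (sym (stays m≤s (n≤1+n _) s<T fm≡fs+1)))

    -- An up-step and a down-step, in either order, would force a revisit by the intermediate values.
    no-step-up-and-down : ∀ {r s} → r < T → s < T → f (suc r) ≡ suc (f r) → suc (f (suc s)) ≡ f s → ⊥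
    no-step-up-and-down {r} {s} r<T s<T up-at-r down-at-s = by-cases (<-cmp r s) (f (suc s) ≤? f r) (f s ≤? f r)
      where
      fr≤fr+1 : f r ≤ f (suc r)
      fr≤fr+1 = ≤-trans (n≤1+n _) (≤-reflexive (sym up-at-r))
      fs+1≤fs : f (suc s) ≤ f s
      fs+1≤fs = ≤-trans (n≤1+n _) (≤-reflexive down-at-s)
      moved-r : f (suc r) ≢ f r
      moved-r e = 1+n≢n (trans (sym up-at-r) e)
      moved-s : f (suc s) ≢ f s
      moved-s e = 1+n≢n (trans down-at-s (sym e))

      by-cases : Tri (r < s) (r ≡ s) (s < r) → Dec (f (suc s) ≤ f r) → Dec (f s ≤ f r) → ⊥
      by-cases (tri≈ _ refl _) _ _ = moved-r (≤-antisym fs+1≤fs fr≤fr+1)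
      by-cases (tri< r<s _ _) (yes fs+1≤fr) _ =
        let m , r<m , m≤s+1 , fm≡fr = intermediate-value↓ down (m≤n⇒m≤1+n r<s) fr≤fr+1 fs+1≤fr
        in left-value-never-revisited r<m (≤-trans m≤s+1 s<T) moved-r fm≡fr
      by-cases (tri< r<s _ _) (no fs+1≰fr) _ =
        let m , r≤m , m≤s , fm≡fs+1 = intermediate-value↑ up (<⇒≤ r<s) (<⇒≤ (≰⇒> fs+1≰fr)) fs+1≤fs
        in entered-value-never-visited m≤s s<T moved-s fm≡fs+1
      by-cases (tri> _ _ s<r) _ (yes fs≤fr) =
        let m , s<m , m≤r , fm≡fs = intermediate-value↑ up s<r fs+1≤fs fs≤fr
        in left-value-never-revisited s<m (≤-trans m≤r (<⇒≤ r<T)) moved-s fm≡fs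
      by-cases (tri> _ _ s<r) _ (no fs≰fr) =
        let m , s≤m , m≤r , fm≡fr+1 = intermediate-value↓ down (<⇒≤ s<r) (subst (_≤ f s) (sym up-at-r) (≰⇒> fs≰fr)) fr≤fr+1
        in entered-value-never-visited m≤r r<T moved-r fm≡fr+1

indicator : ∀ {A : Set} → Dec A → ℕ
indicator (yes _) = 1
indicator (no _) = 0

indicator-cong : ∀ {A B : Set} → A ⇔ B → (a? : Dec A) (b? : Dec B) → indicator a? ≡ indicator b?
indicator-cong A⇔B (yes _) (yes _) = refl
indicator-cong A⇔B (yes a) (no ¬b) = ⊥-elim (¬b (Equivalence.to A⇔B a))
indicator-cong A⇔B (no ¬a) (yes b) = ⊥-elim (¬a (Equivalence.from A⇔B b))
indicator-cong A⇔B (no _) (no _) = refl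

indicator-⊎ : ∀ {A B C : Set} → A ⇔ (B ⊎ C) → (B → ¬ C) →
              (a? : Dec A) (b? : Dec B) (c? : Dec C) → indicator a? ≡ indicator b? + indicator c?
indicator-⊎ A⇔B⊎C disjoint (yes a) (yes b) (yes c) = ⊥-elim (disjoint b c)
indicator-⊎ A⇔B⊎C disjoint (yes a) (yes b) (no _) = refl
indicator-⊎ A⇔B⊎C disjoint (yes a) (no _) (yes c) = refl
indicator-⊎ A⇔B⊎C disjoint (yes a) (no ¬b) (no ¬c) with Equivalence.to A⇔B⊎C a
... | inj₁ b = ⊥-elim (¬b b)
... | inj₂ c = ⊥-elim (¬c c)
indicator-⊎ A⇔B⊎C disjoint (no ¬a) (yes b) _ = ⊥-elim (¬a (Equivalence.from A⇔B⊎C (inj₁ b)))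
indicator-⊎ A⇔B⊎C disjoint (no ¬a) (no _) (yes c) = ⊥-elim (¬a (Equivalence.from A⇔B⊎C (inj₂ c)))
indicator-⊎ A⇔B⊎C disjoint (no _) (no _) (no _) = refl

module _ {N : ℕ} where

  count : {A : Pred (Fin N) 0ℓ} → Decidable A → ℕ
  count A? = sum (λ z → indicator (A? z))

  module _ {A B C : Pred (Fin N) 0ℓ} (A? : Decidable A) (B? : Decidable B) (C? : Decidable C) where

    count-partition : (∀ z → A z ⇔ (B z ⊎ C z)) → (∀ z → B z → ¬ C z) → count A? ≡ count B? + count C?
    count-partition A⇔B⊎C disjoint = trans
      (sum-cong-≗ (λ z → indicator-⊎ (A⇔B⊎C z) (disjoint z) (A? z) (B? z) (C? z)))
      (∑-distrib-+ (λ z → indicator (B? z)) (λ z → indicator (C? z)))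

  count-cong : {A B : Pred (Fin N) 0ℓ} (A? : Decidable A) (B? : Decidable B) →
               (∀ z → A z ⇔ B z) → count A? ≡ count B?
  count-cong A? B? A⇔B = sum-cong-≗ (λ z → indicator-cong (A⇔B z) (A? z) (B? z))

count-⟦⟧≤ : ∀ {N} m → m ≤ N → count {N} (λ x → ⟦ x ⟧ ≤? m) ≡ m
count-⟦⟧≤ {zero} zero z≤n = refl
count-⟦⟧≤ {suc N} zero z≤n = count-⟦⟧≤ {N} zero z≤n
count-⟦⟧≤ {suc N} (suc m) (s≤s m≤N) = cong suc (trans
  (sum-cong-≗ {N} {x = λ x → indicator (suc ⟦ x ⟧ ≤? suc m)} {y = λ x → indicator (⟦ x ⟧ ≤? m)}
    (λ x → indicator-cong (mk⇔ s≤s⁻¹ s≤s) (suc ⟦ x ⟧ ≤? suc m) (⟦ x ⟧ ≤? m)))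
  (count-⟦⟧≤ m m≤N))

⟦⟧-injective : ∀ {m} {x y : Fin m} → ⟦ x ⟧ ≡ ⟦ y ⟧ → x ≡ y
⟦⟧-injective eq = toℕ-injective (suc-injective eq)

∈[]-upper : ∀ {q x y} → x ≤ y → q ∈[ x , y ] → q ≤ y
∈[]-upper _ (inj₁ (_ , q≤y)) = q≤y
∈[]-upper x≤y (inj₂ (_ , q≤x)) = ≤-trans q≤x x≤y

∈[]-lower : ∀ {q x y} → y ≤ x → q ∈[ x , y ] → y ≤ q
∈[]-lower _ (inj₂ (y≤q , _)) = y≤q
∈[]-lower y≤x (inj₁ (x≤q , _)) = ≤-trans y≤x x≤q

CrossingPoint : ∀ {n} → Prefs n → ℕ → (ℕ → Assignment n) → (oa ob : Fin n) (a′ b′ c : ℕ) → Set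
CrossingPoint {n} P t σ oa ob a′ b′ c =
  ((c ∈[ suc ⟦ oa ⟧ , a′ ] × c ∈[ ⟦ ob ⟧ , b′ ]) × SwapIncludesAt P t σ oa ob c) ×
  ((∀ (x : Fin n) → ⟦ oa ⟧ ⊔ b′ ≤ ⟦ x ⟧ → ⟦ x ⟧ < c → P x ob oa) ×
   (∀ (x : Fin n) → c ≤ ⟦ x ⟧ → ⟦ x ⟧ ≤ a′ ⊓ ⟦ ob ⟧ → P x oa ob))

module SwapSequence {n} (P : Prefs n) (P-strict : StrictLinear P) (t : ℕ) (σ : ℕ → Assignment n)
                    (σ-swaps : IsSwapSeq P t σ) where

  leftAgent rightAgent : ∀ {r} → r < t → Fin n
  leftAgent {r} r<t = proj₁ (proj₂ σ-swaps r r<t)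
  rightAgent {r} r<t = proj₁ (proj₂ (proj₂ σ-swaps r r<t))

  swapAt : ∀ {r} (r<t : r < t) → SwapAt P (σ r) (leftAgent r<t) (rightAgent r<t) (σ (suc r))
  swapAt {r} r<t = proj₂ (proj₂ (proj₂ σ-swaps r r<t))

  σ-suc : ∀ {r} (r<t : r < t) x → σ (suc r) x ≡ σ r (transpose (leftAgent r<t) (rightAgent r<t) x)
  σ-suc r<t = proj₂ (proj₂ (proj₂ (swapAt r<t)))

  -- Frozen after the last swap, so that positions form a total sequence ℕ → ℕ.
  follow : ∀ {r} → Dec (r < t) → Fin n → Fin n
  follow (yes r<t) = transpose (rightAgent r<t) (leftAgent r<t)
  follow (no _) y = y

  holder : ℕ → Fin n → Fin n
  holder zero z = z
  holder (suc r) z = follow (r <? t) (holder r z)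

  holder-suc : ∀ {r} (r<t : r < t) z → holder (suc r) z ≡ transpose (rightAgent r<t) (leftAgent r<t) (holder r z)
  holder-suc {r} r<t z rewrite dec-yes-irr (r <? t) <-irrelevant r<t = refl

  σ-holder : ∀ {r} → r ≤ t → ∀ z → σ r (holder r z) ≡ z
  σ-holder {zero} _ z = proj₁ σ-swaps z
  σ-holder {suc r} r<t z = begin
    σ (suc r) (holder (suc r) z)              ≡⟨ cong (σ (suc r)) (holder-suc r<t z) ⟩
    σ (suc r) (transpose j i (holder r z))    ≡⟨ σ-suc r<t _ ⟩
    σ r (transpose i j (transpose j i (holder r z))) ≡⟨ cong (σ r) (transpose-inverse i j) ⟩
    σ r (holder r z)                          ≡⟨ σ-holder (<⇒≤ r<t) z ⟩
    z                                         ∎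
    where
    open ≡-Reasoning
    i j : Fin n
    i = leftAgent r<t
    j = rightAgent r<t

  holder-σ : ∀ {r} → r ≤ t → ∀ x → holder r (σ r x) ≡ x
  holder-σ {zero} _ x = proj₁ σ-swaps x
  holder-σ {suc r} r<t x = begin
    holder (suc r) (σ (suc r) x)              ≡⟨ holder-suc r<t _ ⟩
    transpose j i (holder r (σ (suc r) x))    ≡⟨ cong (λ o → transpose j i (holder r o)) (σ-suc r<t x) ⟩
    transpose j i (holder r (σ r (transpose i j x))) ≡⟨ cong (transpose j i) (holder-σ (<⇒≤ r<t) _) ⟩
    transpose j i (transpose i j x)           ≡⟨ transpose-inverse j i ⟩
    x                                         ∎
    where
    open ≡-Reasoning
    i j : Fin n
    i = leftAgent r<t
    j = rightAgent r<t

  position : ℕ → Fin n → ℕ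
  position r z = ⟦ holder r z ⟧

  position-injective : ∀ {r z w} → r ≤ t → position r z ≡ position r w → z ≡ w
  position-injective {r} {z} {w} r≤t eq = begin
    z                  ≡⟨ σ-holder r≤t z ⟨
    σ r (holder r z)   ≡⟨ cong (σ r) (⟦⟧-injective eq) ⟩
    σ r (holder r w)   ≡⟨ σ-holder r≤t w ⟩
    w                  ∎
    where open ≡-Reasoning

  holds-at : ∀ {r z x} → r ≤ t → position r z ≡ ⟦ x ⟧ → σ r x ≡ z
  holds-at {r} {z} r≤t eq = subst (λ y → σ r y ≡ z) (⟦⟧-injective eq) (σ-holder r≤t z)

  final-position : ∀ {o h} → HolderIs (σ t) o h → position t o ≡ h
  final-position {o} holds = holds (holder t o) (σ-holder ≤-refl o)

  position≤n : ∀ r z → position r z ≤ n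
  position≤n r z = toℕ<n (holder r z)

  count-positions≤ : ∀ {r} → r ≤ t → ∀ m → m ≤ n → count (λ z → position r z ≤? m) ≡ m
  count-positions≤ {r} r≤t m m≤n = trans
    (sym (sum-permute (λ x → indicator (⟦ x ⟧ ≤? m)) (permutation (holder r) (σ r) (holder-σ r≤t) (σ-holder r≤t))))
    (count-⟦⟧≤ m m≤n)

  module _ (x : Fin n) where
    open IsStrictTotalOrder (P-strict x) using (irrefl) renaming (trans to ≻-trans)

    holding-step : ∀ {r} → r < t → σ (suc r) x ≡ σ r x ⊎ P x (σ (suc r) x) (σ r x)
    holding-step r<t with transpose-cases (leftAgent r<t) (rightAgent r<t) x
    ... | inj₁ (refl , x↦j) = inj₂ (subst (λ o → P x o (σ _ x)) (sym (trans (σ-suc r<t x) (cong (σ _) x↦j)))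
                                           (proj₁ (proj₂ (swapAt r<t))))
    ... | inj₂ (inj₁ (refl , x↦i)) = inj₂ (subst (λ o → P x o (σ _ x)) (sym (trans (σ-suc r<t x) (cong (σ _) x↦i)))
                                                  (proj₁ (proj₂ (proj₂ (swapAt r<t)))))
    ... | inj₂ (inj₂ x↦x) = inj₁ (trans (σ-suc r<t x) (cong (σ _) x↦x))

    holding-improves : ∀ {r₁ r₂} → r₁ ≤ r₂ → r₂ ≤ t → σ r₂ x ≡ σ r₁ x ⊎ P x (σ r₂ x) (σ r₁ x)
    holding-improves {r₁} r₁≤r₂ = go (≤⇒≤′ r₁≤r₂)
      where
      go : ∀ {r₂} → r₁ ≤′ r₂ → r₂ ≤ t → σ r₂ x ≡ σ r₁ x ⊎ P x (σ r₂ x) (σ r₁ x)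
      go ≤′-refl _ = inj₁ refl
      go {suc r} (≤′-step r₁≤′r) r<t with go r₁≤′r (<⇒≤ r<t) | holding-step r<t
      ... | inj₁ same | inj₁ same′ = inj₁ (trans same′ same)
      ... | inj₁ same | inj₂ better′ = inj₂ (subst (P x (σ (suc r) x)) same better′)
      ... | inj₂ better | inj₁ same′ = inj₂ (subst (λ o → P x o (σ r₁ x)) (sym same′) better)
      ... | inj₂ better | inj₂ better′ = inj₂ (≻-trans better′ better)

    holding-constant-between : ∀ {r₁ m r₂ o} → r₁ ≤ m → m ≤ r₂ → r₂ ≤ t → σ r₁ x ≡ o → σ r₂ x ≡ o → σ m x ≡ o
    holding-constant-between {m = m} r₁≤m m≤r₂ r₂≤t refl held₂
      with holding-improves r₁≤m (≤-trans m≤r₂ r₂≤t) | holding-improves m≤r₂ r₂≤t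
    ... | inj₁ same | _ = same
    ... | inj₂ _ | inj₁ same = trans (sym same) held₂
    ... | inj₂ better | inj₂ better′ = ⊥-elim (irrefl refl (≻-trans (subst (λ o → P x o (σ m x)) held₂ better′) better))

    prefers-later : ∀ {r₁ r₂ o o′} → r₁ ≤ r₂ → r₂ ≤ t → σ r₁ x ≡ o → σ r₂ x ≡ o′ → o ≢ o′ → P x o′ o
    prefers-later r₁≤r₂ r₂≤t refl refl o≢o′ with holding-improves r₁≤r₂ r₂≤t
    ... | inj₁ same = ⊥-elim (o≢o′ (sym same))
    ... | inj₂ better = better

  MovesRight MovesLeft : Fin n → ℕ → Set
  MovesRight z r = position (suc r) z ≡ suc (position r z)
  MovesLeft z r = suc (position (suc r) z) ≡ position r z

  position-step : ∀ r z → position (suc r) z ≡ position r z ⊎ MovesRight z r ⊎ MovesLeft z r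
  position-step r z with r <? t
  ... | no _ = inj₁ refl
  ... | yes r<t with transpose-cases (rightAgent r<t) (leftAgent r<t) (holder r z)
  ...   | inj₁ (at-j , ↦i) = inj₂ (inj₂ (begin
          suc ⟦ transpose j i (holder r z) ⟧ ≡⟨ cong (λ y → suc ⟦ y ⟧) ↦i ⟩
          suc ⟦ i ⟧                          ≡⟨ proj₁ (swapAt r<t) ⟨
          ⟦ j ⟧                              ≡⟨ cong ⟦_⟧ at-j ⟨
          ⟦ holder r z ⟧                     ∎))
    where
    open ≡-Reasoning
    i j : Fin n
    i = leftAgent r<t
    j = rightAgent r<t
  ...   | inj₂ (inj₁ (at-i , ↦j)) = inj₂ (inj₁ (begin
          ⟦ transpose j i (holder r z) ⟧ ≡⟨ cong ⟦_⟧ ↦j ⟩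
          ⟦ j ⟧                          ≡⟨ proj₁ (swapAt r<t) ⟩
          suc ⟦ i ⟧                      ≡⟨ cong (λ y → suc ⟦ y ⟧) at-i ⟨
          suc ⟦ holder r z ⟧             ∎))
    where
    open ≡-Reasoning
    i j : Fin n
    i = leftAgent r<t
    j = rightAgent r<t
  ...   | inj₂ (inj₂ ↦self) = inj₁ (cong ⟦_⟧ ↦self)

  position-step-up : ∀ r z → position (suc r) z ≤ suc (position r z)
  position-step-up r z with position-step r z
  ... | inj₁ stays = ≤-trans (≤-reflexive stays) (n≤1+n _)
  ... | inj₂ (inj₁ right) = ≤-reflexive right
  ... | inj₂ (inj₂ left) = ≤-trans (n≤1+n _) (≤-trans (≤-reflexive left) (n≤1+n _))

  position-step-down : ∀ r z → position r z ≤ suc (position (suc r) z)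
  position-step-down r z with position-step r z
  ... | inj₁ stays = ≤-trans (≤-reflexive (sym stays)) (n≤1+n _)
  ... | inj₂ (inj₁ right) = ≤-trans (n≤1+n _) (≤-trans (≤-reflexive (sym right)) (n≤1+n _))
  ... | inj₂ (inj₂ left) = ≤-reflexive (sym left)

  movesRight⇒<t : ∀ {z r} → MovesRight z r → r < t
  movesRight⇒<t {z} {r} right with r <? t
  ... | yes r<t = r<t
  ... | no _ = ⊥-elim (1+n≢n (sym right))

  movesLeft⇒<t : ∀ {z r} → MovesLeft z r → r < t
  movesLeft⇒<t {z} {r} left with r <? t
  ... | yes r<t = r<t
  ... | no _ = ⊥-elim (1+n≢n left)

  -- Agents' holdings only improve, so an agent regains an object only if it never gave it away.
  position-revisit : ∀ {u m v z} → u ≤ m → m ≤ v → v ≤ t → position u z ≡ position v z → position m z ≡ position u z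
  position-revisit {u} {m} {v} {z} u≤m m≤v v≤t same = cong ⟦_⟧ (begin
    holder m z              ≡⟨ cong (holder m) held-at-m ⟨
    holder m (σ m x)        ≡⟨ holder-σ (≤-trans m≤v v≤t) x ⟩
    x                       ∎)
    where
    open ≡-Reasoning
    x = holder u z
    held-at-m : σ m x ≡ z
    held-at-m = holding-constant-between x u≤m m≤v v≤t (σ-holder (≤-trans u≤m (≤-trans m≤v v≤t)) z) (holds-at v≤t (sym same))

  moves-one-way : ∀ {z r s} → MovesRight z r → MovesLeft z s → ⊥
  moves-one-way {z} right left =
    no-step-up-and-down (λ r → position r z) (λ r → position-step-up r z) (λ r → position-step-down r z)
      t position-revisit (movesRight⇒<t right) (movesLeft⇒<t left) right left

  right-mover-is-leftAgent : ∀ {z r} (r<t : r < t) → MovesRight z r → holder r z ≡ leftAgent r<t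
  right-mover-is-leftAgent {z} {r} r<t right with transpose-cases (rightAgent r<t) (leftAgent r<t) (holder r z)
  ... | inj₂ (inj₁ (at-i , _)) = at-i
  ... | inj₁ (at-j , ↦i) = ⊥-elim (m≢1+n+m ⟦ leftAgent r<t ⟧ {1} (begin
      ⟦ leftAgent r<t ⟧               ≡⟨ cong ⟦_⟧ (trans (holder-suc r<t z) ↦i) ⟨
      position (suc r) z              ≡⟨ right ⟩
      suc ⟦ holder r z ⟧              ≡⟨ cong (λ y → suc ⟦ y ⟧) at-j ⟩
      suc ⟦ rightAgent r<t ⟧          ≡⟨ cong suc (proj₁ (swapAt r<t)) ⟩
      suc (suc ⟦ leftAgent r<t ⟧)     ∎))
    where open ≡-Reasoning
  ... | inj₂ (inj₂ ↦self) = ⊥-elim (1+n≢n (trans (sym right) (cong ⟦_⟧ (trans (holder-suc r<t z) ↦self))))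

  Exchange : Fin n → Fin n → ℕ → Set
  Exchange x y r = MovesRight x r × MovesLeft y r × suc (position r x) ≡ position r y

  adjacent-exchange : ∀ {r x y} → position r x < position r y → position (suc r) y < position (suc r) x → Exchange x y r
  adjacent-exchange {r} {x} {y} x<y y<x =
      ≤-antisym (position-step-up r x) (≤-trans x<y (≤-trans (position-step-down r y) y<x))
    , ≤-antisym (≤-trans y<x (≤-trans (position-step-up r x) x<y)) (position-step-down r y)
    , ≤-antisym x<y (≤-trans (position-step-down r y) (≤-trans y<x (position-step-up r x)))

  crossing : ∀ {s s′ x y} → s ≤ s′ → s′ ≤ t → position s x < position s y → position s′ y < position s′ x →
             Σ[ r ∈ ℕ ] s ≤ r × r < s′ × Exchange x y r
  crossing {s} {x = x} {y} s≤s′ s′≤t x<y = go (≤⇒≤′ s≤s′) s′≤t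
    where
    go : ∀ {s′} → s ≤′ s′ → s′ ≤ t → position s′ y < position s′ x → Σ[ r ∈ ℕ ] s ≤ r × r < s′ × Exchange x y r
    go ≤′-refl _ y<x = ⊥-elim (<-asym x<y y<x)
    go {suc r} (≤′-step s≤′r) r<t y<x with <-cmp (position r x) (position r y)
    ... | tri< x<y′ _ _ = r , ≤′⇒≤ s≤′r , ≤-refl , adjacent-exchange x<y′ y<x
    ... | tri≈ _ same _ = ⊥-elim (<-irrefl (cong (position s) (position-injective (<⇒≤ r<t) same)) x<y)
    ... | tri> _ _ y<x′ = let r′ , s≤r′ , r′<r , exch = go s≤′r (<⇒≤ r<t) y<x′ in r′ , s≤r′ , m≤n⇒m≤1+n r′<r , exch

  order-preserved : ∀ {s s′ x y} → s ≤ s′ → s′ ≤ t → position s x < position s y →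
                    (∀ {r} → MovesRight x r → ¬ MovesLeft y r) → position s′ x < position s′ y
  order-preserved {s} {s′} {x} {y} s≤s′ s′≤t x<y no-exchange with <-cmp (position s′ x) (position s′ y)
  ... | tri< x<y′ _ _ = x<y′
  ... | tri≈ _ same _ = ⊥-elim (<-irrefl (cong (position s) (position-injective s′≤t same)) x<y)
  ... | tri> _ _ y<x = let _ , _ , _ , right , left , _ = crossing s≤s′ s′≤t x<y y<x in ⊥-elim (no-exchange right left)

  never-left⇒position-mono : ∀ {z u v} → (∀ r → ¬ MovesLeft z r) → u ≤ v → position u z ≤ position v z
  never-left⇒position-mono {z} never-left = monotone-by-steps (λ r → position r z) step
    where
    step : ∀ r → position r z ≤ position (suc r) z
    step r with position-step r z
    ... | inj₁ stays = ≤-reflexive (sym stays)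
    ... | inj₂ (inj₁ right) = ≤-trans (n≤1+n _) (≤-reflexive (sym right))
    ... | inj₂ (inj₂ left) = ⊥-elim (never-left r left)

  never-right⇒position-antitone : ∀ {z u v} → (∀ r → ¬ MovesRight z r) → u ≤ v → position v z ≤ position u z
  never-right⇒position-antitone {z} never-right = antitone-by-steps (λ r → position r z) step
    where
    step : ∀ r → position (suc r) z ≤ position r z
    step r with position-step r z
    ... | inj₁ stays = ≤-reflexive stays
    ... | inj₂ (inj₁ right) = ⊥-elim (never-right r right)
    ... | inj₂ (inj₂ left) = ≤-trans (n≤1+n _) (≤-reflexive left)

  passes-through↑ : ∀ {u v z x} → u ≤ v → v ≤ t → position u z ≤ ⟦ x ⟧ → ⟦ x ⟧ ≤ position v z →
                    Σ[ m ∈ ℕ ] u ≤ m × m ≤ v × σ m x ≡ z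
  passes-through↑ {z = z} u≤v v≤t below above =
    let m , u≤m , m≤v , at-x = intermediate-value↑ (λ r → position r z) (λ r → position-step-up r z) u≤v below above
    in m , u≤m , m≤v , holds-at (≤-trans m≤v v≤t) at-x

  passes-through↓ : ∀ {u v z x} → u ≤ v → v ≤ t → ⟦ x ⟧ ≤ position u z → position v z ≤ ⟦ x ⟧ →
                    Σ[ m ∈ ℕ ] u ≤ m × m ≤ v × σ m x ≡ z
  passes-through↓ {z = z} u≤v v≤t above below =
    let m , u≤m , m≤v , at-x = intermediate-value↓ (λ r → position r z) (λ r → position-step-down r z) u≤v above below
    in m , u≤m , m≤v , holds-at (≤-trans m≤v v≤t) at-x

  module Extremes (ℓ : ℕ) (o₁ oₙ : Fin n) (o₁-first : ⟦ o₁ ⟧ ≡ 1) (oₙ-last : ⟦ oₙ ⟧ ≡ n)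
                  (o₁-final : position t o₁ ≡ suc ℓ) (oₙ-final : position t oₙ ≡ ℓ) where

    never-left⇒ends-right-of-ℓ : ∀ {z} → (∀ r → ¬ MovesLeft z r) → ℓ < position t z
    never-left⇒ends-right-of-ℓ {z} never-left with z ≟ᶠ o₁
    ... | yes refl = ≤-reflexive (sym o₁-final)
    ... | no z≢o₁ = ≤-trans (≤-reflexive (sym o₁-final)) (<⇒≤ (order-preserved z≤n ≤-refl o₁<z (λ _ → never-left _)))
      where
      o₁<z : ⟦ o₁ ⟧ < ⟦ z ⟧
      o₁<z = ≤∧≢⇒< (subst (_≤ ⟦ z ⟧) (sym o₁-first) (s≤s z≤n)) (λ same → z≢o₁ (sym (⟦⟧-injective same)))

    never-right⇒ends-left-of-ℓ : ∀ {z} → (∀ r → ¬ MovesRight z r) → position t z ≤ ℓ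
    never-right⇒ends-left-of-ℓ {z} never-right with z ≟ᶠ oₙ
    ... | yes refl = ≤-reflexive oₙ-final
    ... | no z≢oₙ = ≤-trans (<⇒≤ (order-preserved z≤n ≤-refl z<oₙ (λ right _ → never-right _ right))) (≤-reflexive oₙ-final)
      where
      z<oₙ : ⟦ z ⟧ < ⟦ oₙ ⟧
      z<oₙ = ≤∧≢⇒< (subst (⟦ z ⟧ ≤_) (sym oₙ-last) (toℕ<n z)) (λ same → z≢oₙ (⟦⟧-injective same))

    module ExchangeAt (A B : Fin n) (r₀ : ℕ) (exchange : Exchange A B r₀) (a′ b′ : ℕ)
                      (A-final : position t A ≡ a′) (B-final : position t B ≡ b′) where

      private
        r₀<t : r₀ < t
        r₀<t = movesRight⇒<t (proj₁ exchange)

        r₀≤t : r₀ ≤ t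
        r₀≤t = <⇒≤ r₀<t

        s : ℕ
        s = suc r₀

        c : ℕ
        c = position r₀ B

        adjacent : suc (position r₀ A) ≡ c
        adjacent = proj₂ (proj₂ exchange)

        A-after : position s A ≡ c
        A-after = trans (proj₁ exchange) adjacent

        B-after : suc (position s B) ≡ c
        B-after = proj₁ (proj₂ exchange)

        A-never-left : ∀ r → ¬ MovesLeft A r
        A-never-left _ = moves-one-way (proj₁ exchange)

        B-never-right : ∀ r → ¬ MovesRight B r
        B-never-right _ right = moves-one-way right (proj₁ (proj₂ exchange))

        A≢B : A ≢ B
        A≢B refl = 1+n≢n adjacent

        ℓ<a′ : ℓ < a′
        ℓ<a′ = subst (ℓ <_) A-final (never-left⇒ends-right-of-ℓ A-never-left)

        b′≤ℓ : b′ ≤ ℓ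
        b′≤ℓ = subst (_≤ ℓ) B-final (never-right⇒ends-left-of-ℓ B-never-right)

        is-A-after : ∀ {z} → position s z ≡ c → z ≡ A
        is-A-after at-c = position-injective r₀<t (trans at-c (sym A-after))

      OvertakesA EndsRightOfB : Fin n → Set
      OvertakesA z = c < position s z × position t z ≤ a′
      EndsRightOfB z = b′ < position t z × position t z ≤ ℓ

      overtakesA? : Decidable OvertakesA
      overtakesA? z = (c <? position s z) ×-dec (position t z ≤? a′)

      endsRightOfB? : Decidable EndsRightOfB
      endsRightOfB? z = (b′ <? position t z) ×-dec (position t z ≤? ℓ)

      overtakesA⇔endsRightOfB : ∀ z → OvertakesA z ⇔ EndsRightOfB z
      overtakesA⇔endsRightOfB z = mk⇔ to from
        where
        to : OvertakesA z → EndsRightOfB z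
        to (c<z , z≤a′) = subst (_< position t z) B-final B<z , never-right⇒ends-left-of-ℓ z-never-right
          where
          z<A : position t z < position t A
          z<A = ≤∧≢⇒< (subst (position t z ≤_) (sym A-final) z≤a′)
                      (λ same → <-irrefl (sym A-after) (subst (λ w → c < position s w) (position-injective ≤-refl same) c<z))
          z-never-right : ∀ r → ¬ MovesRight z r
          z-never-right r right =
            let _ , _ , _ , _ , z-left , _ = crossing r₀<t ≤-refl (subst (_< position s z) (sym A-after) c<z) z<A
            in moves-one-way right z-left
          B<z : position t B < position t z
          B<z = order-preserved r₀<t ≤-refl (≤-trans (≤-reflexive B-after) (<⇒≤ c<z)) (λ right _ → B-never-right _ right)

        from : EndsRightOfB z → OvertakesA z
        from (b′<z , z≤ℓ) = c<z , ≤-trans z≤ℓ (<⇒≤ ℓ<a′)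
          where
          c<z : c < position s z
          c<z with <-cmp (position s B) (position s z)
          ... | tri< B<z _ _ = ≤∧≢⇒< (subst (_≤ position s z) B-after B<z)
                                     (λ at-c → <⇒≱ ℓ<a′ (subst (_≤ ℓ) A-final (subst (λ w → position t w ≤ ℓ) (is-A-after (sym at-c)) z≤ℓ)))
          ... | tri≈ _ same _ = ⊥-elim (<-irrefl (cong (position t) (position-injective r₀<t same)) (subst (_< position t z) (sym B-final) b′<z))
          ... | tri> _ _ z<B =
            let _ , _ , _ , z-right , _ = crossing r₀<t ≤-refl z<B (subst (_< position t z) (sym B-final) b′<z)
            in ⊥-elim (<⇒≱ (never-left⇒ends-right-of-ℓ (λ _ → moves-one-way z-right)) z≤ℓ)

      a′≡c+overtakers : a′ ≡ c + count overtakesA?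
      a′≡c+overtakers = begin
        a′                                                      ≡⟨ count-positions≤ ≤-refl a′ (subst (_≤ n) A-final (position≤n t A)) ⟨
        count (λ z → position t z ≤? a′)                        ≡⟨ count-partition _ (λ z → position s z ≤? c) overtakesA? split disjoint ⟩
        count (λ z → position s z ≤? c) + count overtakesA?     ≡⟨ cong (_+ count overtakesA?) (count-positions≤ r₀<t c (position≤n r₀ B)) ⟩
        c + count overtakesA?                                   ∎
        where
        open ≡-Reasoning
        stays-left-of-A : ∀ {z} → position s z ≤ c → position t z ≤ a′
        stays-left-of-A {z} z≤c with m≤n⇒m<n∨m≡n z≤c
        ... | inj₁ z<c = <⇒≤ (subst (position t z <_) A-final
                (order-preserved r₀<t ≤-refl (subst (position s z <_) (sym A-after) z<c) (λ _ → A-never-left _)))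
        ... | inj₂ at-c = ≤-reflexive (trans (cong (position t) (is-A-after at-c)) A-final)
        split : ∀ z → (position t z ≤ a′) ⇔ (position s z ≤ c ⊎ OvertakesA z)
        split z = mk⇔ (λ z≤a′ → map₂ (λ z≰c → ≰⇒> z≰c , z≤a′) (toSum (position s z ≤? c)))
                      [ stays-left-of-A , proj₂ ]
        disjoint : ∀ z → position s z ≤ c → ¬ OvertakesA z
        disjoint z z≤c (c<z , _) = ≤⇒≯ z≤c c<z

      ℓ≡b′+enders : ℓ ≡ b′ + count endsRightOfB?
      ℓ≡b′+enders = begin
        ℓ                                                       ≡⟨ count-positions≤ ≤-refl ℓ (subst (_≤ n) oₙ-final (position≤n t oₙ)) ⟨
        count (λ z → position t z ≤? ℓ)                         ≡⟨ count-partition _ (λ z → position t z ≤? b′) endsRightOfB? split disjoint ⟩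
        count (λ z → position t z ≤? b′) + count endsRightOfB?  ≡⟨ cong (_+ count endsRightOfB?) (count-positions≤ ≤-refl b′ (subst (_≤ n) B-final (position≤n t B))) ⟩
        b′ + count endsRightOfB?                                ∎
        where
        open ≡-Reasoning
        split : ∀ z → (position t z ≤ ℓ) ⇔ (position t z ≤ b′ ⊎ EndsRightOfB z)
        split z = mk⇔ (λ z≤ℓ → map₂ (λ z≰b′ → ≰⇒> z≰b′ , z≤ℓ) (toSum (position t z ≤? b′)))
                      [ (λ z≤b′ → ≤-trans z≤b′ b′≤ℓ) , proj₂ ]
        disjoint : ∀ z → position t z ≤ b′ → ¬ EndsRightOfB z
        disjoint z z≤b′ (b′<z , _) = ≤⇒≯ z≤b′ b′<z

      crossing-position : c + ℓ ≡ a′ + b′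
      crossing-position = begin
        c + ℓ                              ≡⟨ cong (c +_) ℓ≡b′+enders ⟩
        c + (b′ + count endsRightOfB?)     ≡⟨ cong (λ m → c + (b′ + m)) (count-cong overtakesA? endsRightOfB? overtakesA⇔endsRightOfB) ⟨
        c + (b′ + count overtakesA?)       ≡⟨ cong (c +_) (+-comm b′ _) ⟩
        c + (count overtakesA? + b′)       ≡⟨ +-assoc c _ b′ ⟨
        c + count overtakesA? + b′         ≡⟨ cong (_+ b′) a′≡c+overtakers ⟨
        a′ + b′                            ∎
        where open ≡-Reasoning

      crossing-point : CrossingPoint P t σ A B a′ b′ c
      crossing-point = ((inj₁ (a<c , c≤a′) , inj₂ (b′≤c , c≤b)) , swap) , prefers-B-before-c , prefers-A-from-c
        where
        a<c : suc ⟦ A ⟧ ≤ c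
        a<c = ≤-trans (s≤s (never-left⇒position-mono {v = r₀} A-never-left z≤n)) (≤-reflexive adjacent)
        c≤a′ : c ≤ a′
        c≤a′ = subst₂ _≤_ A-after A-final (never-left⇒position-mono A-never-left r₀<t)
        b′≤c : b′ ≤ c
        b′≤c = subst₂ _≤_ B-final B-after (≤-trans (never-right⇒position-antitone B-never-right r₀<t) (n≤1+n _))
        c≤b : c ≤ ⟦ B ⟧
        c≤b = never-right⇒position-antitone {v = r₀} B-never-right z≤n

        A-at-left : holder r₀ A ≡ leftAgent r₀<t
        A-at-left = right-mover-is-leftAgent r₀<t (proj₁ exchange)
        left+1≡c : suc ⟦ leftAgent r₀<t ⟧ ≡ c
        left+1≡c = trans (cong (λ y → suc ⟦ y ⟧) (sym A-at-left)) adjacent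
        right≡c : ⟦ rightAgent r₀<t ⟧ ≡ c
        right≡c = trans (proj₁ (swapAt r₀<t)) left+1≡c
        swap : SwapIncludesAt P t σ A B c
        swap = r₀ , r₀<t , leftAgent r₀<t , rightAgent r₀<t , cong (_∸ 1) left+1≡c , right≡c , swapAt r₀<t
             , inj₁ (subst (λ y → σ r₀ y ≡ A) A-at-left (σ-holder r₀≤t A) , holds-at r₀≤t (sym right≡c))

        prefers-B-before-c : ∀ x → ⟦ A ⟧ ⊔ b′ ≤ ⟦ x ⟧ → ⟦ x ⟧ < c → P x B A
        prefers-B-before-c x lower x<c =
          let u , _ , u≤r₀ , A-at-u = passes-through↑ z≤n r₀≤t (m⊔n≤o⇒m≤o ⟦ A ⟧ b′ lower)
                                        (s≤s⁻¹ (subst (⟦ x ⟧ <_) (sym adjacent) x<c))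
              v , s≤v , v≤t , B-at-v = passes-through↓ r₀<t ≤-refl (s≤s⁻¹ (subst (⟦ x ⟧ <_) (sym B-after) x<c))
                                         (subst (_≤ ⟦ x ⟧) (sym B-final) (m⊔n≤o⇒n≤o ⟦ A ⟧ b′ lower))
          in prefers-later x (≤-trans u≤r₀ (≤-trans (n≤1+n r₀) s≤v)) v≤t A-at-u B-at-v A≢B

        prefers-A-from-c : ∀ x → c ≤ ⟦ x ⟧ → ⟦ x ⟧ ≤ a′ ⊓ ⟦ B ⟧ → P x A B
        prefers-A-from-c x c≤x upper =
          let u , _ , u≤r₀ , B-at-u = passes-through↓ z≤n r₀≤t (m≤n⊓o⇒m≤o a′ ⟦ B ⟧ upper) c≤x
              v , s≤v , v≤t , A-at-v = passes-through↑ r₀<t ≤-refl (subst (_≤ ⟦ x ⟧) (sym A-after) c≤x)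
                                         (subst (⟦ x ⟧ ≤_) (sym A-final) (m≤n⊓o⇒m≤n a′ ⟦ B ⟧ upper))
          in prefers-later x (≤-trans u≤r₀ (≤-trans (n≤1+n r₀) s≤v)) v≤t B-at-u A-at-v (A≢B ∘ sym)

lemma8 : (n k : ℕ) → 2 ≤ k → k ≤ n →
    (P : Prefs n) → StrictLinear P →
    (t : ℕ) (σ : ℕ → Assignment n) → IsSwapSeq P t σ →
    (∀ o → ⟦ o ⟧ ≡ 1 → HolderIs (σ t) o k) →
    (∀ o → ⟦ o ⟧ ≡ n → HolderIs (σ t) o (k ∸ 1)) →
    (oa ob : Fin n) → ⟦ oa ⟧ < ⟦ ob ⟧ →
    (a' b' : ℕ) → HolderIs (σ t) oa a' → HolderIs (σ t) ob b' →
    ⟦ oa ⟧ < a' → b' < ⟦ ob ⟧ →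
    (Σ ℕ λ q → q ∈[ ⟦ oa ⟧ , a' ] × q ∈[ ⟦ ob ⟧ , b' ]) →
    let c = a' + b' + 1 ∸ k in
    ((c ∈[ suc ⟦ oa ⟧ , a' ] × c ∈[ ⟦ ob ⟧ , b' ]) ×
     SwapIncludesAt P t σ oa ob c) ×
    ((∀ (x : Fin n) → ⟦ oa ⟧ ⊔ b' ≤ ⟦ x ⟧ → ⟦ x ⟧ < c → P x ob oa) ×
     (∀ (x : Fin n) → c ≤ ⟦ x ⟧ → ⟦ x ⟧ ≤ a' ⊓ ⟦ ob ⟧ → P x oa ob))
lemma8 (suc n) (suc (suc k)) (s≤s (s≤s z≤n)) (s≤s _) P P-strict t σ σ-swaps o₁-final oₙ-final
       oa ob a<b a′ b′ oa-final ob-final a<a′ b′<b (q , q∈[a,a′] , q∈[b,b′]) =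
  subst (CrossingPoint P t σ oa ob a′ b′) (sym c-formula) crossing-point
  where
  open SwapSequence P P-strict t σ σ-swaps
  open Extremes (suc k) zero (fromℕ n) refl (cong suc (toℕ-fromℕ n))
                (final-position (o₁-final zero refl)) (final-position (oₙ-final (fromℕ n) (cong suc (toℕ-fromℕ n))))

  ob-before-oa : position t ob < position t oa
  ob-before-oa = subst₂ _<_ (sym (final-position ob-final)) (sym (final-position oa-final))
    (≤∧≢⇒< (≤-trans (∈[]-lower (<⇒≤ b′<b) q∈[b,b′]) (∈[]-upper (<⇒≤ a<a′) q∈[a,a′]))
           (λ b′≡a′ → <-irrefl (cong ⟦_⟧ (position-injective ≤-refl
                        (trans (final-position oa-final) (trans (sym b′≡a′) (sym (final-position ob-final)))))) a<b))

  exchange : Σ[ r ∈ ℕ ] 0 ≤ r × r < t × Exchange oa ob r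
  exchange = crossing z≤n ≤-refl a<b ob-before-oa

  r₀ : ℕ
  r₀ = proj₁ exchange
  open ExchangeAt oa ob r₀ (proj₂ (proj₂ (proj₂ exchange))) a′ b′ (final-position oa-final) (final-position ob-final)

  c-formula : a′ + b′ + 1 ∸ suc (suc k) ≡ position r₀ ob
  c-formula = begin
    a′ + b′ + 1 ∸ suc ℓ      ≡⟨ cong (λ m → m + 1 ∸ suc ℓ) crossing-position ⟨
    c + ℓ + 1 ∸ suc ℓ        ≡⟨ cong (_∸ suc ℓ) (trans (+-assoc c ℓ 1) (cong (c +_) (+-comm ℓ 1))) ⟩
    c + suc ℓ ∸ suc ℓ        ≡⟨ m+n∸n≡m c (suc ℓ) ⟩
    c                        ∎
    where
    open ≡-Reasoning
    ℓ c : ℕ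
    ℓ = suc k
    c = position r₀ ob
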